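{- Let $\pi=b_0+b_1i+b_2j+b_3k\in\mathcal{L}$ be a Hurwitz prime of odd prime norm $p$, and let $\xi\in\mathcal{L}$ be a prime quaternion with $\operatorname{N}(\xi)=q$, where $q$ is a prime distinct from $p$. Put $\delta_1=b_1+b_0i$, $\delta_2=b_2+b_0j$, $\delta_3=b_3+b_0k$. Then the class of $\pi$ is a fixed point of the metacommutation map $\tau_{\xi,p}$ if and only if $\Re(\delta_s\pi\xi)\equiv 0\pmod p$ for each $s\in\{1,2,3\}$.
   Context: $\mathcal{L}=\{a+bi+cj+dk: a,b,c,d\in\mathbb{Z}\}$ is the ring of Lipschitz quaternions and $\mathcal{H}=\{\tfrac12(a+bi+cj+dk): a,b,c,d\in\mathbb{Z},\ a\equiv b\equiv c\equiv d \pmod 2\}$ the ring of Hurwitz quaternions in the Hamilton quaternions ($i^2=j^2=k^2=ijk=-1$). For $\alpha=a+bi+cj+dk$, $\Re(\alpha)=a$ and $\operatorname{N}(\alpha)=a^2+b^2+c^2+d^2$. A Hurwitz prime (prime quaternion) is an element of $\mathcal{H}$ whose norm is a rational prime. For an odd prime $p$, $\Pi_p$ is the set of classes of Hurwitz primes of norm $p$ modulo left multiplication by units of $\mathcal{H}$. For primes $p\neq q$, $\pi$ of norm $p$, $\xi$ of norm $q$, one has $\pi\xi=\xi'\pi'$ with $\operatorname{N}(\xi')=q$, $\operatorname{N}(\pi')=p$, where $[\pi']\in\Pi_p$ depends only on $[\pi]$ and $\xi$; the metacommutation map is $\tau_{\xi,p}:\Pi_p\to\Pi_p$, $[\pi]\mapsto[\pi']$.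 -}

module Defs where

open import Data.Nat using (ℕ)
open import Data.Nat.Primality using (Prime)
open import Data.Integer using (ℤ; +_; _+_; _-_; _*_)
open import Data.Integer.Divisibility using (_∣_)
open import Data.Product using (Σ; _×_; ∃; ∃-syntax; _,_)
open import Relation.Binary.PropositionalEquality using (_≡_)

-- Integer Hamilton quaternions a + b i + c j + d k  (a,b,c,d ∈ ℤ).
-- The Lipschitz quaternions 𝓛 are exactly the elements of this type.

record Quat : Set where
  constructor quat
  field
    re : ℤ
    ci : ℤ
    cj : ℤ
    ck : ℤ
open Quat public

-- Hamilton product (i² = j² = k² = ijk = -1)
infixl 7 _⊗_
_⊗_ : Quat → Quat → Quat
quat a1 b1 c1 d1 ⊗ quat a2 b2 c2 d2 = quat
  (a1 * a2 - b1 * b2 - c1 * c2 - d1 * d2)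
  (a1 * b2 + b1 * a2 + c1 * d2 - d1 * c2)
  (a1 * c2 - b1 * d2 + c1 * a2 + d1 * b2)
  (a1 * d2 + b1 * c2 - c1 * b2 + d1 * a2)

infixr 8 _·_
_·_ : ℤ → Quat → Quat
n · quat a b c d = quat (n * a) (n * b) (n * c) (n * d)

Re : Quat → ℤ
Re = re

N : Quat → ℤ
N (quat a b c d) = a * a + b * b + c * c + d * d

-- Hurwitz quaternions, in doubled coordinates.
-- A Hurwitz quaternion α = ½(a + bi + cj + dk) with a ≡ b ≡ c ≡ d (mod 2)
-- is represented by the integer quaternion A = 2α = a + bi + cj + dk.
-- Under this encoding: N(A) = 4 N(α); the Hurwitz product αβ corresponds
-- to the relation A ⊗ B ≡ 2 · C (C = 2αβ); a Lipschitz quaternion x ∈ 𝓛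
-- is the Hurwitz quaternion represented by 2 · x.

IsHurwitz₂ : Quat → Set
IsHurwitz₂ (quat a b c d) = (+ 2 ∣ a - b) × (+ 2 ∣ a - c) × (+ 2 ∣ a - d)

dbl : Quat → Quat
dbl x = (+ 2) · x

IsHurwitzUnit₂ : Quat → Set
IsHurwitzUnit₂ U = IsHurwitz₂ U × N U ≡ + 4

-- Same class modulo left multiplication by units of 𝓗:
-- P/2 and Q/2 are in the same class iff  Q/2 = u · (P/2)  for a unit u,
-- i.e. (with U = 2u)  U ⊗ P ≡ 2 · Q.
SameClass₂ : Quat → Quat → Set
SameClass₂ P Q = ∃[ U ] (IsHurwitzUnit₂ U × U ⊗ P ≡ (+ 2) · Q)

-- Metacommutation relation: for π of norm p and ξ of norm q (both
-- Lipschitz here), Π' (doubled) represents a π' ∈ 𝓗 with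
--   π ξ = ξ' π' ,  N(ξ') = q , N(π') = p ,  ξ' ∈ 𝓗 .
-- With Ξ' = 2ξ', Π' = 2π' the equation reads  Ξ' ⊗ Π' ≡ 4 · (π ⊗ ξ).
Metacomm₂ : (p q : ℕ) → Quat → Quat → Quat → Set
Metacomm₂ p q ξ π Π' =
  IsHurwitz₂ Π' × N Π' ≡ + 4 * + p ×
  ∃[ Ξ' ] (IsHurwitz₂ Ξ' × N Ξ' ≡ + 4 * + q × Ξ' ⊗ Π' ≡ (+ 4) · (π ⊗ ξ))

-- [π] is a fixed point of τ_{ξ,p}:  τ_{ξ,p}([π]) = [π'] = [π],
-- i.e. some metacommutation partner π' of π lies in the class of π.
IsFixedPoint : (p q : ℕ) → Quat → Quat → Set
IsFixedPoint p q ξ π = ∃[ Π' ] (Metacomm₂ p q ξ π Π' × SameClass₂ (dbl π) Π')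

δ₁ δ₂ δ₃ : Quat → Quat
δ₁ (quat b0 b1 b2 b3) = quat b1 b0 (+ 0) (+ 0)
δ₂ (quat b0 b1 b2 b3) = quat b2 (+ 0) b0 (+ 0)
δ₃ (quat b0 b1 b2 b3) = quat b3 (+ 0) (+ 0) b0

{-# OPTIONS --safe #-}
-- [π] is fixed by τ_{ξ,p} exactly when πξ = ηπ for some η of norm q, i.e. when π′ can be taken to be π
-- itself. Multiplying on the right by π̄: if πξ = ξ′uπ with u a unit, then 4πξπ̄ = p (2ξ′)(2u); conversely
-- η = πξπ̄ / p works as soon as p divides πξπ̄ in 𝓛. As p is odd, [π] is a fixed point iff p ∣ πξπ̄.
-- The real part of πξπ̄ is N(π) Re ξ, and since 2δₛ = eₛπ̄ + π̄eₛ (e₁, e₂, e₃ = i, j, k) and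
-- Re (αβ) = Re (βα), we get 2 Re (δₛπξ) = − N(π) ξₛ − (πξπ̄)ₛ: so p ∣ Re (δₛπξ) iff p divides the
-- s-th imaginary coordinate of πξπ̄.
module Submission where

open import Defs
open import Data.Nat using (ℕ)
open import Data.Nat.Primality using (Prime)
open import Data.Integer using (ℤ; +_)
open import Data.Integer.Divisibility using (_∣_)
open import Data.Product using (_×_)
open import Relation.Binary.PropositionalEquality using (_≡_; _≢_)
open import Relation.Nullary using (¬_)
open import Function.Bundles using (_⇔_)

import Data.Nat as ℕ
open import Data.Nat.Coprimality using (coprime-divisor; prime⇒coprime)
open import Data.Nat.Divisibility using () renaming (_∣_ to _∣ℕ_)
open import Data.Nat.Primality using (prime⇒nonTrivial; prime⇒nonZero)
open import Data.Nat.Properties using (≤∧≢⇒<)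
open import Data.Integer using (-_; _+_; _-_; _*_; NonZero)
open import Data.Integer.Properties using (abs-*; neg-involutive; *-assoc; *-comm; *-cancelˡ-≡; *-cancelʳ-≡)
open import Data.Integer.Divisibility.Signed
  using (divides; ∣-refl; ∣-reflexive; ∣⇒∣ᵤ; ∣ᵤ⇒∣; ∣m⇒∣-m; ∣m⇒∣m*n; ∣n⇒∣m*n; ∣m∣n⇒∣m-n; ∣m+n∣m⇒∣n; ∣m+n∣n⇒∣m)
  renaming (_∣_ to _∣ˢ_)
open import Data.Integer.Tactic.RingSolver using (solve)
open import Data.List using (List; []; _∷_)
open import Data.Product using (_,_; ∃-syntax; proj₂)
open import Data.Product.Function.NonDependent.Propositional using (_×-⇔_)
open import Function.Bundles using (mk⇔)
import Function.Properties.Equivalence as ⇔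
open import Relation.Binary.PropositionalEquality using (refl; sym; trans; cong; subst; module ≡-Reasoning)

open ≡-Reasoning

conj : Quat → Quat
conj (quat a b c d) = quat a (- b) (- c) (- d)

one : Quat
one = quat (+ 1) (+ 0) (+ 0) (+ 0)

quat-≡ : ∀ {a b c d a′ b′ c′ d′} →
  a ≡ a′ → b ≡ b′ → c ≡ c′ → d ≡ d′ → quat a b c d ≡ quat a′ b′ c′ d′
quat-≡ refl refl refl refl = refl

conj-involutive : ∀ A → conj (conj A) ≡ A
conj-involutive (quat a b c d) = quat-≡ refl (neg-involutive b) (neg-involutive c) (neg-involutive d)

-- The ring solver does not unfold _⊗_, so coordinate identities are stated in unfolded form.
⊗-assoc : ∀ A B C → (A ⊗ B) ⊗ C ≡ A ⊗ (B ⊗ C)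
⊗-assoc (quat a₁ b₁ c₁ d₁) (quat a₂ b₂ c₂ d₂) (quat a₃ b₃ c₃ d₃) = quat-≡ re-eq ci-eq cj-eq ck-eq
  where
  vs : List ℤ
  vs = a₁ ∷ b₁ ∷ c₁ ∷ d₁ ∷ a₂ ∷ b₂ ∷ c₂ ∷ d₂ ∷ a₃ ∷ b₃ ∷ c₃ ∷ d₃ ∷ []
  re-eq : (a₁ * a₂ - b₁ * b₂ - c₁ * c₂ - d₁ * d₂) * a₃ - (a₁ * b₂ + b₁ * a₂ + c₁ * d₂ - d₁ * c₂) * b₃
        - (a₁ * c₂ - b₁ * d₂ + c₁ * a₂ + d₁ * b₂) * c₃ - (a₁ * d₂ + b₁ * c₂ - c₁ * b₂ + d₁ * a₂) * d₃
        ≡ a₁ * (a₂ * a₃ - b₂ * b₃ - c₂ * c₃ - d₂ * d₃) - b₁ * (a₂ * b₃ + b₂ * a₃ + c₂ * d₃ - d₂ * c₃)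
        - c₁ * (a₂ * c₃ - b₂ * d₃ + c₂ * a₃ + d₂ * b₃) - d₁ * (a₂ * d₃ + b₂ * c₃ - c₂ * b₃ + d₂ * a₃)
  re-eq = solve vs
  ci-eq : (a₁ * a₂ - b₁ * b₂ - c₁ * c₂ - d₁ * d₂) * b₃ + (a₁ * b₂ + b₁ * a₂ + c₁ * d₂ - d₁ * c₂) * a₃
        + (a₁ * c₂ - b₁ * d₂ + c₁ * a₂ + d₁ * b₂) * d₃ - (a₁ * d₂ + b₁ * c₂ - c₁ * b₂ + d₁ * a₂) * c₃
        ≡ a₁ * (a₂ * b₃ + b₂ * a₃ + c₂ * d₃ - d₂ * c₃) + b₁ * (a₂ * a₃ - b₂ * b₃ - c₂ * c₃ - d₂ * d₃)
        + c₁ * (a₂ * d₃ + b₂ * c₃ - c₂ * b₃ + d₂ * a₃) - d₁ * (a₂ * c₃ - b₂ * d₃ + c₂ * a₃ + d₂ * b₃)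
  ci-eq = solve vs
  cj-eq : (a₁ * a₂ - b₁ * b₂ - c₁ * c₂ - d₁ * d₂) * c₃ - (a₁ * b₂ + b₁ * a₂ + c₁ * d₂ - d₁ * c₂) * d₃
        + (a₁ * c₂ - b₁ * d₂ + c₁ * a₂ + d₁ * b₂) * a₃ + (a₁ * d₂ + b₁ * c₂ - c₁ * b₂ + d₁ * a₂) * b₃
        ≡ a₁ * (a₂ * c₃ - b₂ * d₃ + c₂ * a₃ + d₂ * b₃) - b₁ * (a₂ * d₃ + b₂ * c₃ - c₂ * b₃ + d₂ * a₃)
        + c₁ * (a₂ * a₃ - b₂ * b₃ - c₂ * c₃ - d₂ * d₃) + d₁ * (a₂ * b₃ + b₂ * a₃ + c₂ * d₃ - d₂ * c₃)
  cj-eq = solve vs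
  ck-eq : (a₁ * a₂ - b₁ * b₂ - c₁ * c₂ - d₁ * d₂) * d₃ + (a₁ * b₂ + b₁ * a₂ + c₁ * d₂ - d₁ * c₂) * c₃
        - (a₁ * c₂ - b₁ * d₂ + c₁ * a₂ + d₁ * b₂) * b₃ + (a₁ * d₂ + b₁ * c₂ - c₁ * b₂ + d₁ * a₂) * a₃
        ≡ a₁ * (a₂ * d₃ + b₂ * c₃ - c₂ * b₃ + d₂ * a₃) + b₁ * (a₂ * c₃ - b₂ * d₃ + c₂ * a₃ + d₂ * b₃)
        - c₁ * (a₂ * b₃ + b₂ * a₃ + c₂ * d₃ - d₂ * c₃) + d₁ * (a₂ * a₃ - b₂ * b₃ - c₂ * c₃ - d₂ * d₃)
  ck-eq = solve vs

·-⊗-assocˡ : ∀ n A B → (n · A) ⊗ B ≡ n · (A ⊗ B)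
·-⊗-assocˡ n (quat a₁ b₁ c₁ d₁) (quat a₂ b₂ c₂ d₂) = quat-≡ re-eq ci-eq cj-eq ck-eq
  where
  vs : List ℤ
  vs = n ∷ a₁ ∷ b₁ ∷ c₁ ∷ d₁ ∷ a₂ ∷ b₂ ∷ c₂ ∷ d₂ ∷ []
  re-eq : n * a₁ * a₂ - n * b₁ * b₂ - n * c₁ * c₂ - n * d₁ * d₂
        ≡ n * (a₁ * a₂ - b₁ * b₂ - c₁ * c₂ - d₁ * d₂)
  re-eq = solve vs
  ci-eq : n * a₁ * b₂ + n * b₁ * a₂ + n * c₁ * d₂ - n * d₁ * c₂
        ≡ n * (a₁ * b₂ + b₁ * a₂ + c₁ * d₂ - d₁ * c₂)
  ci-eq = solve vs
  cj-eq : n * a₁ * c₂ - n * b₁ * d₂ + n * c₁ * a₂ + n * d₁ * b₂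
        ≡ n * (a₁ * c₂ - b₁ * d₂ + c₁ * a₂ + d₁ * b₂)
  cj-eq = solve vs
  ck-eq : n * a₁ * d₂ + n * b₁ * c₂ - n * c₁ * b₂ + n * d₁ * a₂
        ≡ n * (a₁ * d₂ + b₁ * c₂ - c₁ * b₂ + d₁ * a₂)
  ck-eq = solve vs

·-⊗-assocʳ : ∀ n A B → A ⊗ (n · B) ≡ n · (A ⊗ B)
·-⊗-assocʳ n (quat a₁ b₁ c₁ d₁) (quat a₂ b₂ c₂ d₂) = quat-≡ re-eq ci-eq cj-eq ck-eq
  where
  vs : List ℤ
  vs = n ∷ a₁ ∷ b₁ ∷ c₁ ∷ d₁ ∷ a₂ ∷ b₂ ∷ c₂ ∷ d₂ ∷ []
  re-eq : a₁ * (n * a₂) - b₁ * (n * b₂) - c₁ * (n * c₂) - d₁ * (n * d₂)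
        ≡ n * (a₁ * a₂ - b₁ * b₂ - c₁ * c₂ - d₁ * d₂)
  re-eq = solve vs
  ci-eq : a₁ * (n * b₂) + b₁ * (n * a₂) + c₁ * (n * d₂) - d₁ * (n * c₂)
        ≡ n * (a₁ * b₂ + b₁ * a₂ + c₁ * d₂ - d₁ * c₂)
  ci-eq = solve vs
  cj-eq : a₁ * (n * c₂) - b₁ * (n * d₂) + c₁ * (n * a₂) + d₁ * (n * b₂)
        ≡ n * (a₁ * c₂ - b₁ * d₂ + c₁ * a₂ + d₁ * b₂)
  cj-eq = solve vs
  ck-eq : a₁ * (n * d₂) + b₁ * (n * c₂) - c₁ * (n * b₂) + d₁ * (n * a₂)
        ≡ n * (a₁ * d₂ + b₁ * c₂ - c₁ * b₂ + d₁ * a₂)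
  ck-eq = solve vs

·-·-assoc : ∀ m n A → m · (n · A) ≡ (m * n) · A
·-·-assoc m n (quat a b c d) =
  quat-≡ (sym (*-assoc m n a)) (sym (*-assoc m n b)) (sym (*-assoc m n c)) (sym (*-assoc m n d))

one-⊗ : ∀ A → one ⊗ A ≡ A
one-⊗ (quat a b c d) = quat-≡ (solve vs) (solve vs) (solve vs) (solve vs)
  where
  vs : List ℤ
  vs = a ∷ b ∷ c ∷ d ∷ []

⊗-conj-cancelʳ : ∀ A B → (A ⊗ B) ⊗ conj B ≡ N B · A
⊗-conj-cancelʳ (quat a₁ b₁ c₁ d₁) (quat a₂ b₂ c₂ d₂) = quat-≡ re-eq ci-eq cj-eq ck-eq
  where
  vs : List ℤ
  vs = a₁ ∷ b₁ ∷ c₁ ∷ d₁ ∷ a₂ ∷ b₂ ∷ c₂ ∷ d₂ ∷ []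
  re-eq : (a₁ * a₂ - b₁ * b₂ - c₁ * c₂ - d₁ * d₂) * a₂ - (a₁ * b₂ + b₁ * a₂ + c₁ * d₂ - d₁ * c₂) * (- b₂)
        - (a₁ * c₂ - b₁ * d₂ + c₁ * a₂ + d₁ * b₂) * (- c₂) - (a₁ * d₂ + b₁ * c₂ - c₁ * b₂ + d₁ * a₂) * (- d₂)
        ≡ (a₂ * a₂ + b₂ * b₂ + c₂ * c₂ + d₂ * d₂) * a₁
  re-eq = solve vs
  ci-eq : (a₁ * a₂ - b₁ * b₂ - c₁ * c₂ - d₁ * d₂) * (- b₂) + (a₁ * b₂ + b₁ * a₂ + c₁ * d₂ - d₁ * c₂) * a₂
        + (a₁ * c₂ - b₁ * d₂ + c₁ * a₂ + d₁ * b₂) * (- d₂) - (a₁ * d₂ + b₁ * c₂ - c₁ * b₂ + d₁ * a₂) * (- c₂)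
        ≡ (a₂ * a₂ + b₂ * b₂ + c₂ * c₂ + d₂ * d₂) * b₁
  ci-eq = solve vs
  cj-eq : (a₁ * a₂ - b₁ * b₂ - c₁ * c₂ - d₁ * d₂) * (- c₂) - (a₁ * b₂ + b₁ * a₂ + c₁ * d₂ - d₁ * c₂) * (- d₂)
        + (a₁ * c₂ - b₁ * d₂ + c₁ * a₂ + d₁ * b₂) * a₂ + (a₁ * d₂ + b₁ * c₂ - c₁ * b₂ + d₁ * a₂) * (- b₂)
        ≡ (a₂ * a₂ + b₂ * b₂ + c₂ * c₂ + d₂ * d₂) * c₁
  cj-eq = solve vs
  ck-eq : (a₁ * a₂ - b₁ * b₂ - c₁ * c₂ - d₁ * d₂) * (- d₂) + (a₁ * b₂ + b₁ * a₂ + c₁ * d₂ - d₁ * c₂) * (- c₂)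
        - (a₁ * c₂ - b₁ * d₂ + c₁ * a₂ + d₁ * b₂) * (- b₂) + (a₁ * d₂ + b₁ * c₂ - c₁ * b₂ + d₁ * a₂) * a₂
        ≡ (a₂ * a₂ + b₂ * b₂ + c₂ * c₂ + d₂ * d₂) * d₁
  ck-eq = solve vs

N-⊗ : ∀ A B → N (A ⊗ B) ≡ N A * N B
N-⊗ (quat a₁ b₁ c₁ d₁) (quat a₂ b₂ c₂ d₂) = four-squares
  where
  four-squares :
      (a₁ * a₂ - b₁ * b₂ - c₁ * c₂ - d₁ * d₂) * (a₁ * a₂ - b₁ * b₂ - c₁ * c₂ - d₁ * d₂)
    + (a₁ * b₂ + b₁ * a₂ + c₁ * d₂ - d₁ * c₂) * (a₁ * b₂ + b₁ * a₂ + c₁ * d₂ - d₁ * c₂)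
    + (a₁ * c₂ - b₁ * d₂ + c₁ * a₂ + d₁ * b₂) * (a₁ * c₂ - b₁ * d₂ + c₁ * a₂ + d₁ * b₂)
    + (a₁ * d₂ + b₁ * c₂ - c₁ * b₂ + d₁ * a₂) * (a₁ * d₂ + b₁ * c₂ - c₁ * b₂ + d₁ * a₂)
    ≡ (a₁ * a₁ + b₁ * b₁ + c₁ * c₁ + d₁ * d₁) * (a₂ * a₂ + b₂ * b₂ + c₂ * c₂ + d₂ * d₂)
  four-squares = solve (a₁ ∷ b₁ ∷ c₁ ∷ d₁ ∷ a₂ ∷ b₂ ∷ c₂ ∷ d₂ ∷ [])

N-conj : ∀ A → N (conj A) ≡ N A
N-conj (quat a b c d) = squares
  where
  squares : a * a + (- b) * (- b) + (- c) * (- c) + (- d) * (- d) ≡ a * a + b * b + c * c + d * d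
  squares = solve (a ∷ b ∷ c ∷ d ∷ [])

N-· : ∀ n A → N (n · A) ≡ n * n * N A
N-· n (quat a b c d) = squares
  where
  squares : n * a * (n * a) + n * b * (n * b) + n * c * (n * c) + n * d * (n * d)
          ≡ n * n * (a * a + b * b + c * c + d * d)
  squares = solve (n ∷ a ∷ b ∷ c ∷ d ∷ [])

⊗-conj-⊗-cancelʳ : ∀ A B → (A ⊗ conj B) ⊗ B ≡ N B · A
⊗-conj-⊗-cancelʳ A B = begin
  (A ⊗ conj B) ⊗ B              ≡⟨ cong ((A ⊗ conj B) ⊗_) (conj-involutive B) ⟨
  (A ⊗ conj B) ⊗ conj (conj B)  ≡⟨ ⊗-conj-cancelʳ A (conj B) ⟩
  N (conj B) · A                ≡⟨ cong (_· A) (N-conj B) ⟩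
  N B · A                       ∎

·-cancelˡ : ∀ n {A B} .{{_ : NonZero n}} → n · A ≡ n · B → A ≡ B
·-cancelˡ n {quat _ _ _ _} {quat _ _ _ _} eq = quat-≡
  (*-cancelˡ-≡ n _ _ (cong re eq)) (*-cancelˡ-≡ n _ _ (cong ci eq))
  (*-cancelˡ-≡ n _ _ (cong cj eq)) (*-cancelˡ-≡ n _ _ (cong ck eq))

dbl-⊗-dbl : ∀ A B → dbl A ⊗ dbl B ≡ (+ 4) · (A ⊗ B)
dbl-⊗-dbl A B = begin
  dbl A ⊗ dbl B        ≡⟨ ·-⊗-assocˡ (+ 2) A (dbl B) ⟩
  dbl (A ⊗ dbl B)      ≡⟨ cong dbl (·-⊗-assocʳ (+ 2) A B) ⟩
  dbl (dbl (A ⊗ B))    ≡⟨ ·-·-assoc (+ 2) (+ 2) (A ⊗ B) ⟩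
  (+ 4) · (A ⊗ B)      ∎

dbl-one-⊗ : ∀ A → dbl one ⊗ A ≡ dbl A
dbl-one-⊗ A = trans (·-⊗-assocˡ (+ 2) one A) (cong dbl (one-⊗ A))

dbl-isHurwitz₂ : ∀ A → IsHurwitz₂ (dbl A)
dbl-isHurwitz₂ (quat a b c d) = 2∣2x-2y a b , 2∣2x-2y a c , 2∣2x-2y a d
  where
  2∣2x-2y : ∀ x y → + 2 ∣ + 2 * x - + 2 * y
  2∣2x-2y x y = ∣⇒∣ᵤ (∣m∣n⇒∣m-n (∣m⇒∣m*n x (∣-refl {+ 2})) (∣m⇒∣m*n y ∣-refl))

dbl-one-isHurwitzUnit₂ : IsHurwitzUnit₂ (dbl one)
dbl-one-isHurwitzUnit₂ = dbl-isHurwitz₂ one , refl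

conjugateBy : Quat → Quat → Quat
conjugateBy π ξ = π ⊗ ξ ⊗ conj π

re-conjugateBy : ∀ π ξ → re (conjugateBy π ξ) ≡ N π * re ξ
re-conjugateBy (quat a b c d) (quat x₀ x₁ x₂ x₃) = re-eq
  where
  re-eq : (a * x₀ - b * x₁ - c * x₂ - d * x₃) * a - (a * x₁ + b * x₀ + c * x₃ - d * x₂) * (- b)
        - (a * x₂ - b * x₃ + c * x₀ + d * x₁) * (- c) - (a * x₃ + b * x₂ - c * x₁ + d * x₀) * (- d)
        ≡ (a * a + b * b + c * c + d * d) * x₀
  re-eq = solve (a ∷ b ∷ c ∷ d ∷ x₀ ∷ x₁ ∷ x₂ ∷ x₃ ∷ [])

Re-δ₁-conjugateBy : ∀ π ξ → + 2 * Re (δ₁ π ⊗ π ⊗ ξ) + ci (conjugateBy π ξ) ≡ - (N π * ci ξ)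
Re-δ₁-conjugateBy (quat a b c d) (quat x₀ x₁ x₂ x₃) = identity
  where
  identity :
      + 2 * ((b * a - a * b - + 0 * c - + 0 * d) * x₀ - (b * b + a * a + + 0 * d - + 0 * c) * x₁
             - (b * c - a * d + + 0 * a + + 0 * b) * x₂ - (b * d + a * c - + 0 * b + + 0 * a) * x₃)
    + ((a * x₀ - b * x₁ - c * x₂ - d * x₃) * (- b) + (a * x₁ + b * x₀ + c * x₃ - d * x₂) * a
       + (a * x₂ - b * x₃ + c * x₀ + d * x₁) * (- d) - (a * x₃ + b * x₂ - c * x₁ + d * x₀) * (- c))
    ≡ - ((a * a + b * b + c * c + d * d) * x₁)
  identity = solve (a ∷ b ∷ c ∷ d ∷ x₀ ∷ x₁ ∷ x₂ ∷ x₃ ∷ [])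

Re-δ₂-conjugateBy : ∀ π ξ → + 2 * Re (δ₂ π ⊗ π ⊗ ξ) + cj (conjugateBy π ξ) ≡ - (N π * cj ξ)
Re-δ₂-conjugateBy (quat a b c d) (quat x₀ x₁ x₂ x₃) = identity
  where
  identity :
      + 2 * ((c * a - + 0 * b - a * c - + 0 * d) * x₀ - (c * b + + 0 * a + a * d - + 0 * c) * x₁
             - (c * c - + 0 * d + a * a + + 0 * b) * x₂ - (c * d + + 0 * c - a * b + + 0 * a) * x₃)
    + ((a * x₀ - b * x₁ - c * x₂ - d * x₃) * (- c) - (a * x₁ + b * x₀ + c * x₃ - d * x₂) * (- d)
       + (a * x₂ - b * x₃ + c * x₀ + d * x₁) * a + (a * x₃ + b * x₂ - c * x₁ + d * x₀) * (- b))
    ≡ - ((a * a + b * b + c * c + d * d) * x₂)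
  identity = solve (a ∷ b ∷ c ∷ d ∷ x₀ ∷ x₁ ∷ x₂ ∷ x₃ ∷ [])

Re-δ₃-conjugateBy : ∀ π ξ → + 2 * Re (δ₃ π ⊗ π ⊗ ξ) + ck (conjugateBy π ξ) ≡ - (N π * ck ξ)
Re-δ₃-conjugateBy (quat a b c d) (quat x₀ x₁ x₂ x₃) = identity
  where
  identity :
      + 2 * ((d * a - + 0 * b - + 0 * c - a * d) * x₀ - (d * b + + 0 * a + + 0 * d - a * c) * x₁
             - (d * c - + 0 * d + + 0 * a + a * b) * x₂ - (d * d + + 0 * c - + 0 * b + a * a) * x₃)
    + ((a * x₀ - b * x₁ - c * x₂ - d * x₃) * (- d) + (a * x₁ + b * x₀ + c * x₃ - d * x₂) * (- c)
       - (a * x₂ - b * x₃ + c * x₀ + d * x₁) * (- b) + (a * x₃ + b * x₂ - c * x₁ + d * x₀) * a)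
    ≡ - ((a * a + b * b + c * c + d * d) * x₃)
  identity = solve (a ∷ b ∷ c ∷ d ∷ x₀ ∷ x₁ ∷ x₂ ∷ x₃ ∷ [])

infix 4 _∣ᵠ_

_∣ᵠ_ : ℤ → Quat → Set
n ∣ᵠ A = n ∣ˢ re A × n ∣ˢ ci A × n ∣ˢ cj A × n ∣ˢ ck A

∣ᵠ-· : ∀ n A → n ∣ᵠ n · A
∣ᵠ-· n (quat a b c d) = ∣m⇒∣m*n a ∣-refl , ∣m⇒∣m*n b ∣-refl , ∣m⇒∣m*n c ∣-refl , ∣m⇒∣m*n d ∣-refl

∣ᵠ⇒·-quotient : ∀ {n} A → n ∣ᵠ A → ∃[ B ] n · B ≡ A
∣ᵠ⇒·-quotient {n} (quat a b c d) (divides a′ a≡ , divides b′ b≡ , divides c′ c≡ , divides d′ d≡) =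
  quat a′ b′ c′ d′ , quat-≡ (by a≡) (by b≡) (by c≡) (by d≡)
  where
  by : ∀ {x x′} → x ≡ x′ * n → n * x′ ≡ x
  by {x′ = x′} x≡ = trans (*-comm n x′) (sym x≡)

∣ᵠ-cancelˡ : ∀ {n} m A → (∀ {i} → n ∣ˢ m * i → n ∣ˢ i) → n ∣ᵠ m · A → n ∣ᵠ A
∣ᵠ-cancelˡ _ (quat _ _ _ _) cancel (h₀ , h₁ , h₂ , h₃) = cancel h₀ , cancel h₁ , cancel h₂ , cancel h₃

∣⇔∣ᵤ : ∀ {k i} → k ∣ˢ i ⇔ k ∣ i
∣⇔∣ᵤ = mk⇔ ∣⇒∣ᵤ ∣ᵤ⇒∣

fixedPoint⇒4·conjugateBy : ∀ p q ξ π → IsFixedPoint p q ξ π →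
  ∃[ W ] (+ 4) · conjugateBy π ξ ≡ N π · W
fixedPoint⇒4·conjugateBy _ _ ξ π (Π′ , (_ , _ , Ξ′ , _ , _ , Ξ′Π′≡4πξ) , U , _ , U2π≡2Π′) =
  Ξ′ ⊗ U , (begin
  (+ 4) · (π ⊗ ξ ⊗ conj π)    ≡⟨ ·-⊗-assocˡ (+ 4) (π ⊗ ξ) (conj π) ⟨
  ((+ 4) · (π ⊗ ξ)) ⊗ conj π  ≡⟨ cong (_⊗ conj π) Ξ′Π′≡4πξ ⟨
  (Ξ′ ⊗ Π′) ⊗ conj π          ≡⟨ cong (λ Π → (Ξ′ ⊗ Π) ⊗ conj π) Uπ≡Π′ ⟨
  (Ξ′ ⊗ (U ⊗ π)) ⊗ conj π     ≡⟨ cong (_⊗ conj π) (⊗-assoc Ξ′ U π) ⟨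
  ((Ξ′ ⊗ U) ⊗ π) ⊗ conj π     ≡⟨ ⊗-conj-cancelʳ (Ξ′ ⊗ U) π ⟩
  N π · (Ξ′ ⊗ U)              ∎)
  where
  Uπ≡Π′ : U ⊗ π ≡ Π′
  Uπ≡Π′ = ·-cancelˡ (+ 2) (trans (sym (·-⊗-assocʳ (+ 2) U π)) U2π≡2Π′)

·-conjugateBy⇒intertwines : ∀ {p} π ξ η .{{_ : ℕ.NonZero p}} →
  N π ≡ + p → (+ p) · η ≡ conjugateBy π ξ → η ⊗ π ≡ π ⊗ ξ
·-conjugateBy⇒intertwines {p} π ξ η Nπ pη≡πξπ̄ = ·-cancelˡ (+ p) (begin
  (+ p) · (η ⊗ π)      ≡⟨ ·-⊗-assocˡ (+ p) η π ⟨
  ((+ p) · η) ⊗ π      ≡⟨ cong (_⊗ π) pη≡πξπ̄ ⟩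
  conjugateBy π ξ ⊗ π  ≡⟨ ⊗-conj-⊗-cancelʳ (π ⊗ ξ) π ⟩
  N π · (π ⊗ ξ)        ≡⟨ cong (_· (π ⊗ ξ)) Nπ ⟩
  (+ p) · (π ⊗ ξ)      ∎)

intertwines⇒N≡ : ∀ {p} π ξ η .{{_ : ℕ.NonZero p}} → N π ≡ + p → η ⊗ π ≡ π ⊗ ξ → N η ≡ N ξ
intertwines⇒N≡ {p} π ξ η Nπ ηπ≡πξ = *-cancelʳ-≡ (N η) (N ξ) (+ p) (begin
  N η * + p     ≡⟨ cong (N η *_) Nπ ⟨
  N η * N π     ≡⟨ N-⊗ η π ⟨
  N (η ⊗ π)     ≡⟨ cong N ηπ≡πξ ⟩
  N (π ⊗ ξ)     ≡⟨ N-⊗ π ξ ⟩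
  N π * N ξ     ≡⟨ *-comm (N π) (N ξ) ⟩
  N ξ * N π     ≡⟨ cong (N ξ *_) Nπ ⟩
  N ξ * + p     ∎)

intertwines⇒fixedPoint : ∀ {p q} ξ π η →
  N π ≡ + p → N η ≡ + q → η ⊗ π ≡ π ⊗ ξ → IsFixedPoint p q ξ π
intertwines⇒fixedPoint ξ π η Nπ Nη ηπ≡πξ =
  dbl π ,
  (dbl-isHurwitz₂ π , trans (N-· (+ 2) π) (cong (+ 4 *_) Nπ) ,
   dbl η , dbl-isHurwitz₂ η , trans (N-· (+ 2) η) (cong (+ 4 *_) Nη) ,
   trans (dbl-⊗-dbl η π) (cong ((+ 4) ·_) ηπ≡πξ)) ,
  dbl one , dbl-one-isHurwitzUnit₂ , dbl-one-⊗ (dbl π)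

module _ {p : ℕ} (p-prime : Prime p) (2≢p : 2 ≢ p) where

  odd-prime-∣2* : ∀ {i} → + p ∣ˢ + 2 * i → + p ∣ˢ i
  odd-prime-∣2* {i} p∣2i =
    ∣ᵤ⇒∣ (coprime-divisor (prime⇒coprime p-prime 2<p) (subst (p ∣ℕ_) (abs-* (+ 2) i) (∣⇒∣ᵤ p∣2i)))
    where
    2<p : 2 ℕ.< p
    2<p = ≤∧≢⇒< (ℕ.nonTrivial⇒n>1 p {{prime⇒nonTrivial p-prime}}) 2≢p

  odd-prime-∣4* : ∀ {i} → + p ∣ˢ + 4 * i → + p ∣ˢ i
  odd-prime-∣4* {i} p∣4i = odd-prime-∣2* (odd-prime-∣2* (subst (+ p ∣ˢ_) (*-assoc (+ 2) (+ 2) i) p∣4i))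

  odd-prime-∣2r+x⇒[∣x⇔∣r] : ∀ r x → + p ∣ˢ + 2 * r + x → (+ p ∣ˢ x ⇔ + p ∣ˢ r)
  odd-prime-∣2r+x⇒[∣x⇔∣r] _ _ p∣2r+x = mk⇔
    (λ p∣x → odd-prime-∣2* (∣m+n∣n⇒∣m p∣2r+x p∣x))
    (λ p∣r → ∣m+n∣m⇒∣n p∣2r+x (∣n⇒∣m*n (+ 2) p∣r))

  fixedPoint⇔∣ᵠ-conjugateBy : ∀ {q π ξ} → N π ≡ + p → N ξ ≡ + q →
    IsFixedPoint p q ξ π ⇔ + p ∣ᵠ conjugateBy π ξ
  fixedPoint⇔∣ᵠ-conjugateBy {q} {π} {ξ} Nπ Nξ = mk⇔ to from
    where
    instance
      p≢0 : ℕ.NonZero p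
      p≢0 = prime⇒nonZero p-prime

    to : IsFixedPoint p q ξ π → + p ∣ᵠ conjugateBy π ξ
    to fixed =
      let W , 4πξπ̄≡Nπ·W = fixedPoint⇒4·conjugateBy p q ξ π fixed
      in ∣ᵠ-cancelˡ (+ 4) (conjugateBy π ξ) odd-prime-∣4*
           (subst (+ p ∣ᵠ_) (sym (trans 4πξπ̄≡Nπ·W (cong (_· W) Nπ))) (∣ᵠ-· (+ p) W))

    from : + p ∣ᵠ conjugateBy π ξ → IsFixedPoint p q ξ π
    from p∣πξπ̄ =
      let η , pη≡πξπ̄ = ∣ᵠ⇒·-quotient (conjugateBy π ξ) p∣πξπ̄
          ηπ≡πξ = ·-conjugateBy⇒intertwines π ξ η Nπ pη≡πξπ̄
      in intertwines⇒fixedPoint ξ π η Nπ (trans (intertwines⇒N≡ π ξ η Nπ ηπ≡πξ) Nξ) ηπ≡πξ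

  ∣ᵠ-conjugateBy⇔∣Re-δ : ∀ π ξ → + p ∣ˢ N π →
    + p ∣ᵠ conjugateBy π ξ ⇔
      ((+ p ∣ Re (δ₁ π ⊗ π ⊗ ξ)) × (+ p ∣ Re (δ₂ π ⊗ π ⊗ ξ)) × (+ p ∣ Re (δ₃ π ⊗ π ⊗ ξ)))
  ∣ᵠ-conjugateBy⇔∣Re-δ π ξ p∣Nπ =
    ⇔.trans (mk⇔ proj₂ (p∣re ,_))
      (imaginary δ₁ ci Re-δ₁-conjugateBy ×-⇔
       imaginary δ₂ cj Re-δ₂-conjugateBy ×-⇔
       imaginary δ₃ ck Re-δ₃-conjugateBy)
    where
    p∣re : + p ∣ˢ re (conjugateBy π ξ)
    p∣re = subst (+ p ∣ˢ_) (sym (re-conjugateBy π ξ)) (∣m⇒∣m*n (re ξ) p∣Nπ)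

    imaginary : (δ : Quat → Quat) (im : Quat → ℤ) →
      (∀ α β → + 2 * Re (δ α ⊗ α ⊗ β) + im (conjugateBy α β) ≡ - (N α * im β)) →
      + p ∣ˢ im (conjugateBy π ξ) ⇔ + p ∣ Re (δ π ⊗ π ⊗ ξ)
    imaginary δ im identity = ⇔.trans
      (odd-prime-∣2r+x⇒[∣x⇔∣r] (Re (δ π ⊗ π ⊗ ξ)) (im (conjugateBy π ξ))
        (subst (+ p ∣ˢ_) (sym (identity π ξ)) (∣m⇒∣-m (∣m⇒∣m*n (im ξ) p∣Nπ))))
      ∣⇔∣ᵤ

proposition2 : (p q : ℕ) → Prime p → ¬ (2 ≡ p) → Prime q → p ≢ q →
    (π ξ : Quat) → N π ≡ + p → N ξ ≡ + q →
    IsFixedPoint p q ξ π ⇔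
      ((+ p ∣ Re (δ₁ π ⊗ π ⊗ ξ)) × (+ p ∣ Re (δ₂ π ⊗ π ⊗ ξ)) × (+ p ∣ Re (δ₃ π ⊗ π ⊗ ξ)))
proposition2 _ _ p-prime 2≢p _ _ π ξ Nπ Nξ = ⇔.trans
  (fixedPoint⇔∣ᵠ-conjugateBy p-prime 2≢p Nπ Nξ)
  (∣ᵠ-conjugateBy⇔∣Re-δ p-prime 2≢p π ξ (∣-reflexive (sym Nπ)))
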